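{- Let $C$ be a guarded clause or a loosely guarded clause, and let $\mathcal L$ be the set of eligible literals of $C$ (as defined in the context). Then $\mathrm{Var}(\mathcal L)=\mathrm{Var}(C)$.
   Context: Clauses are finite multisets of literals without equality. A compound term is a term that is neither a variable nor a constant; depth of variables/constants is $0$, of $f(u_1,\dots,u_n)$ it is $1+\max_i$ depth$(u_i)$. $\mathrm{Var}(E)$ is the set of variables of $E$. A literal is flat if every argument is a variable or constant; simple if every argument is a variable, a constant, or $f(u_1,\dots,u_n)$ with each $u_i$ a variable or constant. A clause is flat/simple if all its literals are; covering if every compound term $t$ in $C$ has $\mathrm{Var}(t)=\mathrm{Var}(C)$. A guarded clause is a simple covering clause that is ground or contains a negative flat literal $\neg G$ (guard) with $\mathrm{Var}(G)=\mathrm{Var}(C)$. A loosely guarded clause is a simple covering clause that is ground or contains a set $\mathcal G$ of negative flat literals (loose guards) such that each pair of variables of $C$ co-occurs in a literal of $\mathcal G$. Ordering: $\succ$ is a lexicographic path ordering with precedence function symbols $>$ constants $>$ predicate symbols, extended admissibly to literals; $L$ is (strictly) maximal in $C$ if for some ground $\sigma$, $L\sigma\succeq L'\sigma$ ($\succ$) for all other literals $L'$ of $C$. Eligible literals of $C$: (1) $C$ ground: its maximal literals; (2) else if $C$ has a negative literal with a compound term: one such literal (selected); (3) else if $C$ has a positive literal with a compound term: its maximal literals; (4) else if $C$ is a flat guarded clause: one selected guard; (5) otherwise, writing $C=\neg A_1\vee\dots\vee\neg A_n\vee D$ with all negative literals listed: if the current clause set contains side premises $B_i\vee D_i$ with nothing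 selected, $B_i$ eligible and strictly maximal w.r.t. $D_i$, and a simultaneous mgu $\sigma'$ with $B_i\sigma'=A_i\sigma'$ for all $i$, then the top variables are the variables $x$ of $\neg A_1\vee\dots\vee\neg A_n$ with maximal depth of $x\sigma'$ and the eligible (selected) literals are the $\neg A_i$ containing a top variable; if no such side premises exist, all negative literals are selected. -}

module Defs where

open import Data.Nat using (ℕ; _≤_; _⊔_; suc; zero)
open import Data.Fin using (Fin)
open import Data.List using (List; []; _∷_; length; lookup; tabulate)
open import Data.List.Membership.Propositional using (_∈_)
open import Data.List.Relation.Unary.Any using (Any)
open import Data.List.Relation.Unary.All using (All)
open import Data.List.Relation.Binary.Permutation.Propositional using (_↭_)
open import Data.Vec using (Vec) renaming ([] to []ᵛ; _∷_ to _∷ᵛ_)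
import Data.Vec.Relation.Unary.Any as AnyV
import Data.Vec.Relation.Unary.All as AllV
open import Data.Sum using (_⊎_)
open import Data.Product using (Σ; _×_; proj₁; proj₂; _,_)
open import Relation.Nullary using (¬_)
open import Relation.Binary.PropositionalEquality using (_≡_)
open import Relation.Binary.Structures using (IsStrictTotalOrder)
open import Function.Bundles using (_⇔_)

-- We assume the signature has at least one constant, so that ground
-- substitutions exist (needed for the notion of maximality).

record Signature : Set₁ where
  field
    Fun       : Set
    arity     : Fun → ℕ
    Const     : Set
    Pred      : Set
    predArity : Pred → ℕ
    someConst : Const

module Syntax (S : Signature) where
  open Signature S

  data Term : Set where
    var : ℕ → Term
    con : Const → Term
    fun : (f : Fun) → Vec Term (arity f) → Term

  record Atom : Set where
    constructor atom
    field
      pred : Pred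
      args : Vec Term (predArity pred)

  data Literal : Set where
    pos : Atom → Literal
    neg : Atom → Literal

  atomOf : Literal → Atom
  atomOf (pos A) = A
  atomOf (neg A) = A

  IsPos : Literal → Set
  IsPos L = L ≡ pos (atomOf L)

  IsNeg : Literal → Set
  IsNeg L = L ≡ neg (atomOf L)

  -- clauses: finite multisets of literals, represented as lists
  Clause : Set
  Clause = List Literal

  data _∈ᵗ_ (x : ℕ) : Term → Set where
    here : x ∈ᵗ var x
    inArg : ∀ {f ts} → AnyV.Any (x ∈ᵗ_) ts → x ∈ᵗ fun f ts

  _∈ᵃ_ : ℕ → Atom → Set
  x ∈ᵃ A = AnyV.Any (x ∈ᵗ_) (Atom.args A)

  _∈ᴸ_ : ℕ → Literal → Set
  x ∈ᴸ L = x ∈ᵃ atomOf L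

  _∈ᶜ_ : ℕ → Clause → Set
  x ∈ᶜ C = Any (x ∈ᴸ_) C

  _∈ˢ_ : ℕ → (Literal → Set) → Set
  x ∈ˢ ℒ = Σ Literal λ L → ℒ L × x ∈ᴸ L

  GroundC : Clause → Set
  GroundC C = ∀ x → ¬ (x ∈ᶜ C)

  IsCompound : Term → Set
  IsCompound t = Σ Fun λ f → Σ (Vec Term (arity f)) λ ts → t ≡ fun f ts

  data FlatT : Term → Set where
    fvar : ∀ x → FlatT (var x)
    fcon : ∀ c → FlatT (con c)

  data SimpleT : Term → Set where
    sflat : ∀ {t} → FlatT t → SimpleT t
    sfun  : ∀ {f ts} → AllV.All FlatT ts → SimpleT (fun f ts)

  FlatL : Literal → Set
  FlatL L = AllV.All FlatT (Atom.args (atomOf L))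

  SimpleL : Literal → Set
  SimpleL L = AllV.All SimpleT (Atom.args (atomOf L))

  FlatC : Clause → Set
  FlatC C = All FlatL C

  SimpleC : Clause → Set
  SimpleC C = All SimpleL C

  data _⊴_ (s : Term) : Term → Set where
    refl⊴ : s ⊴ s
    deep  : ∀ {f ts} → AnyV.Any (s ⊴_) ts → s ⊴ fun f ts

  _occursIn_ : Term → Clause → Set
  t occursIn C = Any (λ L → AnyV.Any (t ⊴_) (Atom.args (atomOf L))) C

  Covering : Clause → Set
  Covering C = ∀ t → t occursIn C → IsCompound t → ∀ x → (x ∈ᵗ t ⇔ x ∈ᶜ C)

  IsGuard : Clause → Literal → Set
  IsGuard C L = L ∈ C × IsNeg L × FlatL L × (∀ x → (x ∈ᴸ L ⇔ x ∈ᶜ C))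

  Guarded : Clause → Set
  Guarded C = SimpleC C × Covering C × (GroundC C ⊎ Σ Literal (IsGuard C))

  LooseGuards : Clause → List Literal → Set
  LooseGuards C 𝒢 =
    All (λ L → L ∈ C × IsNeg L × FlatL L) 𝒢 ×
    (∀ x y → x ∈ᶜ C → y ∈ᶜ C → Any (λ L → x ∈ᴸ L × y ∈ᴸ L) 𝒢)

  LooselyGuarded : Clause → Set
  LooselyGuarded C =
    SimpleC C × Covering C × (GroundC C ⊎ Σ (List Literal) (LooseGuards C))

  Subst : Set
  Subst = ℕ → Term

  mutual
    _·_ : Term → Subst → Term
    var x · σ = σ x
    con c · σ = con c
    fun f ts · σ = fun f (ts ·ᵛ σ)

    _·ᵛ_ : ∀ {n} → Vec Term n → Subst → Vec Term n
    []ᵛ ·ᵛ σ = []ᵛ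
    (t ∷ᵛ ts) ·ᵛ σ = (t · σ) ∷ᵛ (ts ·ᵛ σ)

  _·ᵃ_ : Atom → Subst → Atom
  atom p ts ·ᵃ σ = atom p (ts ·ᵛ σ)

  _·ᴸ_ : Literal → Subst → Literal
  pos A ·ᴸ σ = pos (A ·ᵃ σ)
  neg A ·ᴸ σ = neg (A ·ᵃ σ)

  GroundSubst : Subst → Set
  GroundSubst σ = ∀ x y → ¬ (y ∈ᵗ σ x)

  mutual
    depth : Term → ℕ
    depth (var x) = 0
    depth (con c) = 0
    depth (fun f ts) = suc (depthᵛ ts)

    depthᵛ : ∀ {n} → Vec Term n → ℕ
    depthᵛ []ᵛ = 0
    depthᵛ (t ∷ᵛ ts) = depth t ⊔ depthᵛ ts

  Unifies : Subst → List (Atom × Atom) → Set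
  Unifies σ ps = All (λ p → proj₁ p ·ᵃ σ ≡ proj₂ p ·ᵃ σ) ps

  IsMGU : Subst → List (Atom × Atom) → Set
  IsMGU σ ps = Unifies σ ps ×
    (∀ θ → Unifies θ ps → Σ Subst λ δ → ∀ x → θ x ≡ σ x · δ)

  data Sym : Set where
    sfun  : Fun → Sym
    scon  : Const → Sym
    spred : Pred → Sym

  record Precedence : Set₁ where
    field
      _⊐_       : Sym → Sym → Set
      isSTO     : IsStrictTotalOrder _≡_ _⊐_
      fun>con   : ∀ f c → sfun f ⊐ scon c
      con>pred  : ∀ c p → scon c ⊐ spred p
      fun>pred  : ∀ f p → sfun f ⊐ spred p

  -- terms and atoms as first-order trees (used for the LPO)
  data Tree : Set where
    leaf : ℕ → Tree
    node : Sym → List Tree → Tree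

  mutual
    toTree : Term → Tree
    toTree (var x) = leaf x
    toTree (con c) = node (scon c) []
    toTree (fun f ts) = node (sfun f) (toTrees ts)

    toTrees : ∀ {n} → Vec Term n → List Tree
    toTrees []ᵛ = []
    toTrees (t ∷ᵛ ts) = toTree t ∷ toTrees ts

  atomTree : Atom → Tree
  atomTree (atom p ts) = node (spred p) (toTrees ts)

  HasCompound : Literal → Set
  HasCompound L = AnyV.Any IsCompound (Atom.args (atomOf L))

  HasNegCompound : Clause → Set
  HasNegCompound C = Any (λ L → IsNeg L × HasCompound L) C

  HasPosCompound : Clause → Set
  HasPosCompound C = Any (λ L → IsPos L × HasCompound L) C

  negAtoms : Clause → List Atom
  negAtoms [] = []
  negAtoms (pos A ∷ C) = negAtoms C
  negAtoms (neg A ∷ C) = A ∷ negAtoms C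

  _∈⁻_ : ℕ → Clause → Set
  x ∈⁻ C = Any (λ L → IsNeg L × x ∈ᴸ L) C

module Order (S : Signature) (P : Syntax.Precedence S) where
  open Signature S
  open Syntax S
  open Precedence P

  mutual
    data _>ₗ_ : Tree → Tree → Set where
      lpoSub  : ∀ {f ss t} → Any (λ s → s >ₗ t ⊎ s ≡ t) ss → node f ss >ₗ t
      lpoPrec : ∀ {f g ss ts} → f ⊐ g → All (λ t → node f ss >ₗ t) ts →
                node f ss >ₗ node g ts
      lpoLex  : ∀ {f ss ts} → LexGt ss ts → All (λ t → node f ss >ₗ t) ts →
                node f ss >ₗ node f ts

    data LexGt : List Tree → List Tree → Set where
      lexHere  : ∀ {s t ss ts} → s >ₗ t → LexGt (s ∷ ss) (t ∷ ts)
      lexThere : ∀ {s ss ts} → LexGt ss ts → LexGt (s ∷ ss) (s ∷ ts)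

  _≻_ : Literal → Literal → Set
  L ≻ L' = (atomTree (atomOf L) >ₗ atomTree (atomOf L'))
         ⊎ (atomOf L ≡ atomOf L' × IsNeg L × IsPos L')

  _⪰_ : Literal → Literal → Set
  L ⪰ L' = L ≻ L' ⊎ L ≡ L'

  Maximal : Clause → Literal → Set
  Maximal C L = Σ Subst λ σ → GroundSubst σ × All (λ L' → (L ·ᴸ σ) ⪰ (L' ·ᴸ σ)) C

  StrictlyMaximal : Clause → Literal → Set
  StrictlyMaximal D L = Σ Subst λ σ → GroundSubst σ × All (λ L' → (L ·ᴸ σ) ≻ (L' ·ᴸ σ)) D

  -- "nothing selected": the eligible literals of the clause are given by
  -- case (1) or case (3) of the definition (i.e. its maximal literals)
  NothingSelected : Clause → Set
  NothingSelected C = GroundC C ⊎ (¬ GroundC C × ¬ HasNegCompound C × HasPosCompound C)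

  record SidePremise (N : List Clause) : Set where
    field
      clause  : Clause
      inN     : clause ∈ N
      B       : Atom
      D       : Clause
      split   : clause ↭ (pos B ∷ D)
      noSel   : NothingSelected clause
      elig    : Maximal clause (pos B)
      strict  : StrictlyMaximal D (pos B)

  pairs : ∀ {N} (C : Clause) → (Fin (length (negAtoms C)) → SidePremise N) → List (Atom × Atom)
  pairs C sp = tabulate (λ i → SidePremise.B (sp i) , lookup (negAtoms C) i)

  HasSidePremises : List Clause → Clause → Set
  HasSidePremises N C =
    Σ (Fin (length (negAtoms C)) → SidePremise N) λ sp → Σ Subst λ σ → IsMGU σ (pairs C sp)

  TopVar : Clause → Subst → ℕ → Set
  TopVar C σ x = x ∈⁻ C × (∀ y → y ∈⁻ C → depth (σ y) ≤ depth (σ x))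

  -- Eligible N C ℒ : ℒ is (a possible choice of) the set of eligible
  -- literals of C, with N the current clause set.
  data Eligible (N : List Clause) (C : Clause) (ℒ : Literal → Set) : Set where
    case1 : GroundC C →
            (∀ L → ℒ L ⇔ (L ∈ C × Maximal C L)) → Eligible N C ℒ
    case2 : ¬ GroundC C → (L₀ : Literal) → L₀ ∈ C → IsNeg L₀ → HasCompound L₀ →
            (∀ L → ℒ L ⇔ L ≡ L₀) → Eligible N C ℒ
    case3 : ¬ GroundC C → ¬ HasNegCompound C → HasPosCompound C →
            (∀ L → ℒ L ⇔ (L ∈ C × Maximal C L)) → Eligible N C ℒ
    case4 : ¬ GroundC C → ¬ HasNegCompound C → ¬ HasPosCompound C →
            FlatC C → Guarded C → (G : Literal) → IsGuard C G →
            (∀ L → ℒ L ⇔ L ≡ G) → Eligible N C ℒ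
    case5a : ¬ GroundC C → ¬ HasNegCompound C → ¬ HasPosCompound C →
             ¬ (FlatC C × Guarded C) →
             (sp : Fin (length (negAtoms C)) → SidePremise N) →
             (σ' : Subst) → IsMGU σ' (pairs C sp) →
             (∀ L → ℒ L ⇔ (L ∈ C × IsNeg L × Σ ℕ λ x → x ∈ᴸ L × TopVar C σ' x)) →
             Eligible N C ℒ
    case5b : ¬ GroundC C → ¬ HasNegCompound C → ¬ HasPosCompound C →
             ¬ (FlatC C × Guarded C) → ¬ HasSidePremises N C →
             (∀ L → ℒ L ⇔ (L ∈ C × IsNeg L)) → Eligible N C ℒ

module Submission where

-- Every eligible literal is a literal of C, so Var(ℒ) ⊆ Var(C); the content
-- is the converse, which is checked case by case along the definition of
-- eligibility.  A ground clause has no variables.  A selected negative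
-- literal with a compound term contains all variables since C is covering.
-- For the maximal literals of case (3) we show that some maximal literal
-- contains a compound term: instantiating all variables by one constant,
-- literals with compound terms dominate flat ones in the LPO, and the LPO
-- is transitive and total on ground terms, so the compound literals have a
-- greatest element.  A guard contains all variables by definition.  In
-- case (5) we use that any two variables of a loosely guarded clause
-- co-occur in a negative literal (guarded clauses are loosely guarded):
-- pairing x with a top variable, which exists as the depth maximum over the
-- finitely many variables of the negative literals, gives a selected
-- literal containing x.

open import Defs
open import Data.List using (List)
open import Data.Sum using (_⊎_)
open import Function.Bundles using (_⇔_)

open import Data.Nat using (ℕ; suc; _≤_)
open import Data.Nat.Properties using (suc-injective)
open import Data.List using ([]; _∷_; length; _++_; filter)
open import Data.List.Properties using (∷-injective)
open import Data.List.Relation.Unary.Any using (Any; here; there)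
import Data.List.Relation.Unary.Any as Any
open import Data.List.Relation.Unary.All using (All; []; _∷_; lookup; tabulate)
import Data.List.Relation.Unary.All as All
open import Data.List.Membership.Propositional using (_∈_; lose; find)
open import Data.List.Membership.Propositional.Properties
  using (∈-++⁺ˡ; ∈-++⁺ʳ; ∈-++⁻; ∈-filter⁺; ∈-filter⁻)
open import Data.List.Extrema.Nat using (argmax; f[xs]≤f[argmax]; argmax-sel)
open import Data.Vec using (Vec) renaming ([] to []ᵛ; _∷_ to _∷ᵛ_)
import Data.Vec.Relation.Unary.Any as AnyV
open import Data.Sum using (inj₁; inj₂; [_,_]′)
open import Data.Product using (Σ; _×_; _,_; proj₁; proj₂)
open import Data.Empty using (⊥-elim)
open import Relation.Nullary using (¬_; Dec; yes; no)
open import Relation.Unary using (Decidable)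
open import Relation.Binary.Definitions
  using (Reflexive; Transitive; Total; tri<; tri≈; tri>)
open import Relation.Binary.PropositionalEquality
  using (_≡_; refl; sym; trans; cong; cong₂; subst; subst₂)
open import Function.Base using (_∘_; id)
open import Relation.Binary.Structures using (IsStrictTotalOrder)
open import Function.Bundles using (mk⇔; Equivalence)

greatest : {A : Set} (R : A → A → Set) → Reflexive R → Total R → Transitive R →
           ∀ x xs → Σ A λ m → m ∈ x ∷ xs × All (R m) (x ∷ xs)
greatest R refl′ total trans′ x [] = x , here refl , refl′ ∷ []
greatest R refl′ total trans′ x (y ∷ ys) with greatest R refl′ total trans′ y ys
... | m , m∈ , m≥ with total x m
...   | inj₁ x≥m = x , here refl , refl′ ∷ All.map (trans′ x≥m) m≥
...   | inj₂ m≥x = m , there m∈ , m≥x ∷ m≥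

greatest-satisfying : {A : Set} (R : A → A → Set) → Reflexive R → Total R → Transitive R →
                      {P : A → Set} (P? : Decidable P) → ∀ {xs} → Any P xs →
                      Σ A λ m → (m ∈ xs × P m) × All (R m) (filter P? xs)
greatest-satisfying R refl′ total trans′ P? {xs} some with find some
... | x , x∈xs , px with greatest R refl′ total trans′ x (filter P? xs)
...   | m , here refl , _ ∷ m≥ = m , (x∈xs , px) , m≥
...   | m , there m∈ , _ ∷ m≥ = m , ∈-filter⁻ P? m∈ , m≥

module ClauseFacts (S : Signature) where
  open Signature S
  open Syntax S

  symArity : Sym → ℕ
  symArity (sfun f) = arity f
  symArity (scon c) = 0
  symArity (spred p) = predArity p

  data GroundTree : Tree → Set where
    ground : ∀ {f ss} → length ss ≡ symArity f → All GroundTree ss → GroundTree (node f ss)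

  node-injective : ∀ {f g : Sym} {xs ys : List Tree} → node f xs ≡ node g ys → f ≡ g × xs ≡ ys
  node-injective refl = refl , refl

  mutual
    toTree-injective : ∀ s t → toTree s ≡ toTree t → s ≡ t
    toTree-injective (var x) (var .x) refl = refl
    toTree-injective (con c) (con .c) refl = refl
    toTree-injective (fun f ss) (fun g ts) e with node-injective e
    ... | refl , ss≡ts = cong (fun f) (toTrees-injective ss ts ss≡ts)
    toTree-injective (var _) (con _) ()
    toTree-injective (var _) (fun _ _) ()
    toTree-injective (con _) (var _) ()
    toTree-injective (con _) (fun _ _) ()
    toTree-injective (fun _ _) (var _) ()
    toTree-injective (fun _ _) (con _) ()

    toTrees-injective : ∀ {n} (ss ts : Vec Term n) → toTrees ss ≡ toTrees ts → ss ≡ ts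
    toTrees-injective []ᵛ []ᵛ _ = refl
    toTrees-injective (s ∷ᵛ ss) (t ∷ᵛ ts) e =
      cong₂ _∷ᵛ_ (toTree-injective s t (proj₁ (∷-injective e)))
                 (toTrees-injective ss ts (proj₂ (∷-injective e)))

  atomTree-injective : ∀ A B → atomTree A ≡ atomTree B → A ≡ B
  atomTree-injective (atom p ts) (atom q us) e with node-injective e
  ... | refl , ts≡us = cong (atom p) (toTrees-injective ts us ts≡us)

  σ₀ : Subst
  σ₀ _ = con someConst

  σ₀-ground : GroundSubst σ₀
  σ₀-ground x y ()

  length-toTrees : ∀ {n} (ts : Vec Term n) → length (toTrees ts) ≡ n
  length-toTrees []ᵛ = refl
  length-toTrees (t ∷ᵛ ts) = cong suc (length-toTrees ts)

  mutual
    σ₀-groundTerm : ∀ t → GroundTree (toTree (t · σ₀))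
    σ₀-groundTerm (var x) = ground refl []
    σ₀-groundTerm (con c) = ground refl []
    σ₀-groundTerm (fun f ts) = ground (length-toTrees (ts ·ᵛ σ₀)) (σ₀-groundArgs ts)

    σ₀-groundArgs : ∀ {n} (ts : Vec Term n) → All GroundTree (toTrees (ts ·ᵛ σ₀))
    σ₀-groundArgs []ᵛ = []
    σ₀-groundArgs (t ∷ᵛ ts) = σ₀-groundTerm t ∷ σ₀-groundArgs ts

  σ₀-groundLiteral : ∀ L → GroundTree (atomTree (atomOf (L ·ᴸ σ₀)))
  σ₀-groundLiteral (pos (atom p ts)) = ground (length-toTrees (ts ·ᵛ σ₀)) (σ₀-groundArgs ts)
  σ₀-groundLiteral (neg (atom p ts)) = ground (length-toTrees (ts ·ᵛ σ₀)) (σ₀-groundArgs ts)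

  isCompound? : Decidable IsCompound
  isCompound? (var x) = no λ ()
  isCompound? (con c) = no λ ()
  isCompound? (fun f ts) = yes (f , ts , refl)

  hasCompound? : Decidable HasCompound
  hasCompound? L = AnyV.any? isCompound? (Atom.args (atomOf L))

  atomOf-· : ∀ L σ → atomOf (L ·ᴸ σ) ≡ atomOf L ·ᵃ σ
  atomOf-· (pos A) σ = refl
  atomOf-· (neg A) σ = refl

  covering-literal : ∀ {C L x} → Covering C → L ∈ C → HasCompound L → x ∈ᶜ C → x ∈ᴸ L
  covering-literal {C} {L} {x} covering L∈C compound x∈C =
    in-args (Atom.args (atomOf L)) (λ t t⊴ → lose L∈C t⊴) compound
    where
      in-args : ∀ {n} (ts : Vec Term n) → (∀ t → AnyV.Any (t ⊴_) ts → t occursIn C) →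
                AnyV.Any IsCompound ts → AnyV.Any (x ∈ᵗ_) ts
      in-args (t ∷ᵛ _) occurs (AnyV.here c) =
        AnyV.here (Equivalence.from (covering t (occurs t (AnyV.here refl⊴)) c x) x∈C)
      in-args (_ ∷ᵛ ts) occurs (AnyV.there c) =
        AnyV.there (in-args ts (λ t t⊴ → occurs t (AnyV.there t⊴)) c)

  mutual
    termVars : Term → List ℕ
    termVars (var x) = x ∷ []
    termVars (con c) = []
    termVars (fun f ts) = argsVars ts

    argsVars : ∀ {n} → Vec Term n → List ℕ
    argsVars []ᵛ = []
    argsVars (t ∷ᵛ ts) = termVars t ++ argsVars ts

  mutual
    termVars-complete : ∀ {x} t → x ∈ᵗ t → x ∈ termVars t
    termVars-complete (var y) here = here refl
    termVars-complete (fun f ts) (inArg x∈ts) = argsVars-complete ts x∈ts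

    argsVars-complete : ∀ {x n} (ts : Vec Term n) → AnyV.Any (x ∈ᵗ_) ts → x ∈ argsVars ts
    argsVars-complete (t ∷ᵛ ts) (AnyV.here x∈t) = ∈-++⁺ˡ (termVars-complete t x∈t)
    argsVars-complete (t ∷ᵛ ts) (AnyV.there x∈ts) = ∈-++⁺ʳ (termVars t) (argsVars-complete ts x∈ts)

  mutual
    termVars-sound : ∀ {x} t → x ∈ termVars t → x ∈ᵗ t
    termVars-sound (var y) (here refl) = here
    termVars-sound (fun f ts) x∈ = inArg (argsVars-sound ts x∈)

    argsVars-sound : ∀ {x n} (ts : Vec Term n) → x ∈ argsVars ts → AnyV.Any (x ∈ᵗ_) ts
    argsVars-sound (t ∷ᵛ ts) x∈ with ∈-++⁻ (termVars t) x∈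
    ... | inj₁ x∈t = AnyV.here (termVars-sound t x∈t)
    ... | inj₂ x∈ts = AnyV.there (argsVars-sound ts x∈ts)

  negVars : Clause → List ℕ
  negVars [] = []
  negVars (pos A ∷ C) = negVars C
  negVars (neg A ∷ C) = argsVars (Atom.args A) ++ negVars C

  negVars-complete : ∀ {x} C → x ∈⁻ C → x ∈ negVars C
  negVars-complete (pos A ∷ C) (here (() , _))
  negVars-complete (pos A ∷ C) (there x∈C) = negVars-complete C x∈C
  negVars-complete (neg A ∷ C) (here (_ , x∈A)) = ∈-++⁺ˡ (argsVars-complete (Atom.args A) x∈A)
  negVars-complete (neg A ∷ C) (there x∈C) = ∈-++⁺ʳ (argsVars (Atom.args A)) (negVars-complete C x∈C)

  negVars-sound : ∀ {x} C → x ∈ negVars C → x ∈⁻ C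
  negVars-sound (pos A ∷ C) x∈ = there (negVars-sound C x∈)
  negVars-sound (neg A ∷ C) x∈ =
    [ (λ x∈A → here (refl , argsVars-sound (Atom.args A) x∈A)) , (λ x∈C → there (negVars-sound C x∈C)) ]′
      (∈-++⁻ (argsVars (Atom.args A)) x∈)

  top-variable : ∀ C (σ : Subst) {x} → x ∈⁻ C →
                 Σ ℕ λ y → y ∈⁻ C × (∀ z → z ∈⁻ C → depth (σ z) ≤ depth (σ y))
  top-variable C σ {x} x∈C = y , y∈C , λ z z∈C → lookup (f[xs]≤f[argmax] x (negVars C)) (negVars-complete C z∈C)
    where
      y : ℕ
      y = argmax (λ z → depth (σ z)) x (negVars C)

      y∈C : y ∈⁻ C
      y∈C = [ (λ y≡x → subst (_∈⁻ C) (sym y≡x) x∈C) , negVars-sound C ]′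
              (argmax-sel (λ z → depth (σ z)) x (negVars C))

  -- A guard is a family of loose guards on its own.
  guarded⇒looselyGuarded : ∀ {C} → Guarded C → LooselyGuarded C
  guarded⇒looselyGuarded (simple , covering , inj₁ C-ground) = simple , covering , inj₁ C-ground
  guarded⇒looselyGuarded (simple , covering , inj₂ (G , G∈C , G-neg , G-flat , G-vars)) =
    simple , covering , inj₂ (G ∷ [] , (G∈C , G-neg , G-flat) ∷ [] ,
      λ x y x∈C y∈C → here (Equivalence.from (G-vars x) x∈C , Equivalence.from (G-vars y) y∈C))

  co-occurrence : ∀ {C x y} → LooselyGuarded C → x ∈ᶜ C → y ∈ᶜ C →
                  Σ Literal λ L → L ∈ C × IsNeg L × x ∈ᴸ L × y ∈ᴸ L
  co-occurrence {x = x} (_ , _ , inj₁ C-ground) x∈C _ = ⊥-elim (C-ground x x∈C)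
  co-occurrence {x = x} {y} (_ , _ , inj₂ (𝒢 , guards , pairs)) x∈C y∈C =
    let L , L∈𝒢 , x∈L , y∈L = find (pairs x y x∈C y∈C)
        L∈C , L-neg , _ = lookup guards L∈𝒢
    in L , L∈C , L-neg , x∈L , y∈L

module OrderFacts (S : Signature) (P : Syntax.Precedence S) where
  open Signature S
  open Syntax S
  open ClauseFacts S
  open Precedence P
  open Order S P
  private module ⊐ = IsStrictTotalOrder isSTO

  _≥ₗ_ : Tree → Tree → Set
  s ≥ₗ t = s >ₗ t ⊎ s ≡ t

  mutual
    >ₗ-trans : ∀ {s t u} → s >ₗ t → t >ₗ u → s >ₗ u
    >ₗ-trans (lpoSub s⊳t) t>u = lpoSub (argument-≥-trans s⊳t t>u)
    >ₗ-trans (lpoPrec _ s>ts) (lpoSub t⊳u) = above-argument s>ts t⊳u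
    >ₗ-trans (lpoLex _ s>ts) (lpoSub t⊳u) = above-argument s>ts t⊳u
    >ₗ-trans s>t@(lpoPrec f⊐g _) (lpoPrec g⊐h t>us) = lpoPrec (⊐.trans f⊐g g⊐h) (above-all s>t t>us)
    >ₗ-trans s>t@(lpoPrec f⊐g _) (lpoLex _ t>us) = lpoPrec f⊐g (above-all s>t t>us)
    >ₗ-trans s>t@(lpoLex _ _) (lpoPrec g⊐h t>us) = lpoPrec g⊐h (above-all s>t t>us)
    >ₗ-trans s>t@(lpoLex ss>ts _) (lpoLex ts>us t>us) = lpoLex (lex-trans ss>ts ts>us) (above-all s>t t>us)

    argument-≥-trans : ∀ {ss t u} → Any (_≥ₗ t) ss → t >ₗ u → Any (_≥ₗ u) ss
    argument-≥-trans (here (inj₁ s>t)) t>u = here (inj₁ (>ₗ-trans s>t t>u))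
    argument-≥-trans (here (inj₂ refl)) t>u = here (inj₁ t>u)
    argument-≥-trans (there ss≥t) t>u = there (argument-≥-trans ss≥t t>u)

    above-argument : ∀ {s ts u} → All (s >ₗ_) ts → Any (_≥ₗ u) ts → s >ₗ u
    above-argument (s>t ∷ _) (here (inj₁ t>u)) = >ₗ-trans s>t t>u
    above-argument (s>t ∷ _) (here (inj₂ refl)) = s>t
    above-argument (_ ∷ s>ts) (there ts≥u) = above-argument s>ts ts≥u

    above-all : ∀ {s t us} → s >ₗ t → All (t >ₗ_) us → All (s >ₗ_) us
    above-all s>t [] = []
    above-all s>t (t>u ∷ t>us) = >ₗ-trans s>t t>u ∷ above-all s>t t>us

    lex-trans : ∀ {ss ts us} → LexGt ss ts → LexGt ts us → LexGt ss us
    lex-trans (lexHere s>t) (lexHere t>u) = lexHere (>ₗ-trans s>t t>u)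
    lex-trans (lexHere s>t) (lexThere _) = lexHere s>t
    lex-trans (lexThere _) (lexHere t>u) = lexHere t>u
    lex-trans (lexThere ss>ts) (lexThere ts>us) = lexThere (lex-trans ss>ts ts>us)

  Trichotomous : Tree → Tree → Set
  Trichotomous s t = s >ₗ t ⊎ s ≡ t ⊎ t >ₗ s

  mutual
    >ₗ-trichotomous : ∀ {s t} → GroundTree s → GroundTree t → Trichotomous s t
    >ₗ-trichotomous {node f ss} {node g ts} gs@(ground ∣ss∣ gss) gt@(ground ∣ts∣ gts)
      with argument-≥-or-below gss gt
    ... | inj₁ ss≥t = inj₁ (lpoSub ss≥t)
    ... | inj₂ t>ss with argument-≥-or-above gs gts
    ...   | inj₁ ts≥s = inj₂ (inj₂ (lpoSub ts≥s))
    ...   | inj₂ s>ts with ⊐.compare f g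
    ...     | tri< f⊐g _ _ = inj₁ (lpoPrec f⊐g s>ts)
    ...     | tri> _ _ g⊐f = inj₂ (inj₂ (lpoPrec g⊐f t>ss))
    ...     | tri≈ _ refl _ with lex-trichotomous gss gts (trans ∣ss∣ (sym ∣ts∣))
    ...       | inj₁ ss>ts = inj₁ (lpoLex ss>ts s>ts)
    ...       | inj₂ (inj₁ refl) = inj₂ (inj₁ refl)
    ...       | inj₂ (inj₂ ts>ss) = inj₂ (inj₂ (lpoLex ts>ss t>ss))

    argument-≥-or-below : ∀ {ss t} → All GroundTree ss → GroundTree t →
                          Any (_≥ₗ t) ss ⊎ All (t >ₗ_) ss
    argument-≥-or-below [] gt = inj₂ []
    argument-≥-or-below (gs ∷ gss) gt with >ₗ-trichotomous gs gt
    ... | inj₁ s>t = inj₁ (here (inj₁ s>t))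
    ... | inj₂ (inj₁ s≡t) = inj₁ (here (inj₂ s≡t))
    ... | inj₂ (inj₂ t>s) with argument-≥-or-below gss gt
    ...   | inj₁ ss≥t = inj₁ (there ss≥t)
    ...   | inj₂ t>ss = inj₂ (t>s ∷ t>ss)

    argument-≥-or-above : ∀ {s ts} → GroundTree s → All GroundTree ts →
                          Any (_≥ₗ s) ts ⊎ All (s >ₗ_) ts
    argument-≥-or-above gs [] = inj₂ []
    argument-≥-or-above gs (gt ∷ gts) with >ₗ-trichotomous gs gt
    ... | inj₂ (inj₂ t>s) = inj₁ (here (inj₁ t>s))
    ... | inj₂ (inj₁ s≡t) = inj₁ (here (inj₂ (sym s≡t)))
    ... | inj₁ s>t with argument-≥-or-above gs gts
    ...   | inj₁ ts≥s = inj₁ (there ts≥s)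
    ...   | inj₂ s>ts = inj₂ (s>t ∷ s>ts)

    lex-trichotomous : ∀ {ss ts} → All GroundTree ss → All GroundTree ts →
                       length ss ≡ length ts → LexGt ss ts ⊎ ss ≡ ts ⊎ LexGt ts ss
    lex-trichotomous [] [] _ = inj₂ (inj₁ refl)
    lex-trichotomous (gs ∷ gss) (gt ∷ gts) ∣ss∣≡∣ts∣ with >ₗ-trichotomous gs gt
    ... | inj₁ s>t = inj₁ (lexHere s>t)
    ... | inj₂ (inj₂ t>s) = inj₂ (inj₂ (lexHere t>s))
    ... | inj₂ (inj₁ refl) with lex-trichotomous gss gts (suc-injective ∣ss∣≡∣ts∣)
    ...   | inj₁ ss>ts = inj₁ (lexThere ss>ts)
    ...   | inj₂ (inj₁ refl) = inj₂ (inj₁ refl)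
    ...   | inj₂ (inj₂ ts>ss) = inj₂ (inj₂ (lexThere ts>ss))

  ≻-trans : ∀ {K L M} → K ≻ L → L ≻ M → K ≻ M
  ≻-trans (inj₁ K>L) (inj₁ L>M) = inj₁ (>ₗ-trans K>L L>M)
  ≻-trans {K} (inj₁ K>L) (inj₂ (L≡M , _)) =
    inj₁ (subst (λ A → atomTree (atomOf K) >ₗ atomTree A) L≡M K>L)
  ≻-trans {M = M} (inj₂ (K≡L , _)) (inj₁ L>M) =
    inj₁ (subst (λ A → atomTree A >ₗ atomTree (atomOf M)) (sym K≡L) L>M)
  ≻-trans (inj₂ (_ , _ , L-pos)) (inj₂ (_ , L-neg , _)) = ⊥-elim (pos≢neg (trans (sym L-pos) L-neg))
    where pos≢neg : ∀ {A B} → ¬ pos A ≡ neg B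
          pos≢neg ()

  ⪰-trans : ∀ {K L M} → K ⪰ L → L ⪰ M → K ⪰ M
  ⪰-trans (inj₁ K≻L) (inj₁ L≻M) = inj₁ (≻-trans K≻L L≻M)
  ⪰-trans K⪰L (inj₂ refl) = K⪰L
  ⪰-trans (inj₂ refl) L⪰M = L⪰M

  same-atom-comparable : ∀ K L → atomOf K ≡ atomOf L → K ⪰ L ⊎ L ⪰ K
  same-atom-comparable (pos A) (pos .A) refl = inj₁ (inj₂ refl)
  same-atom-comparable (neg A) (neg .A) refl = inj₁ (inj₂ refl)
  same-atom-comparable (neg A) (pos .A) refl = inj₁ (inj₁ (inj₂ (refl , refl , refl)))
  same-atom-comparable (pos A) (neg .A) refl = inj₂ (inj₁ (inj₂ (refl , refl , refl)))

  ⪰-total : ∀ K L → GroundTree (atomTree (atomOf K)) → GroundTree (atomTree (atomOf L)) →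
            K ⪰ L ⊎ L ⪰ K
  ⪰-total K L gK gL = by-trees (>ₗ-trichotomous gK gL)
    where
      by-trees : Trichotomous (atomTree (atomOf K)) (atomTree (atomOf L)) → K ⪰ L ⊎ L ⪰ K
      by-trees (inj₁ K>L) = inj₁ (inj₁ (inj₁ K>L))
      by-trees (inj₂ (inj₂ L>K)) = inj₂ (inj₁ (inj₁ L>K))
      by-trees (inj₂ (inj₁ K≡L)) =
        same-atom-comparable K L (atomTree-injective (atomOf K) (atomOf L) K≡L)

  _⪰₀_ : Literal → Literal → Set
  K ⪰₀ L = (K ·ᴸ σ₀) ⪰ (L ·ᴸ σ₀)

  ⪰₀-total : Total _⪰₀_
  ⪰₀-total K L = ⪰-total (K ·ᴸ σ₀) (L ·ᴸ σ₀) (σ₀-groundLiteral K) (σ₀-groundLiteral L)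

  function-above-flat : ∀ {n} f X (us : Vec Term n) → ¬ AnyV.Any IsCompound us →
                        All (node (sfun f) X >ₗ_) (toTrees (us ·ᵛ σ₀))
  function-above-flat f X []ᵛ _ = []
  function-above-flat f X (var x ∷ᵛ us) flat =
    lpoPrec (fun>con f someConst) [] ∷ function-above-flat f X us (flat ∘ AnyV.there)
  function-above-flat f X (con c ∷ᵛ us) flat =
    lpoPrec (fun>con f c) [] ∷ function-above-flat f X us (flat ∘ AnyV.there)
  function-above-flat f X (fun g vs ∷ᵛ us) flat = ⊥-elim (flat (AnyV.here (g , vs , refl)))

  compound-argument : ∀ {n T} (ts : Vec Term n) → AnyV.Any IsCompound ts →
                      (∀ f X → node (sfun f) X >ₗ T) → Any (_≥ₗ T) (toTrees (ts ·ᵛ σ₀))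
  compound-argument (_ ∷ᵛ _) (AnyV.here (f , vs , refl)) fun>T = here (inj₁ (fun>T f _))
  compound-argument (_ ∷ᵛ ts) (AnyV.there c) fun>T = there (compound-argument ts c fun>T)

  -- Under σ₀ a literal with a compound term exceeds every flat literal: the
  -- compound argument's head function symbol dominates the predicate symbol
  -- and all the constants of the flat literal.
  compound-above-flat : ∀ K L → HasCompound K → ¬ HasCompound L → K ⪰₀ L
  compound-above-flat K L cK flatL =
    inj₁ (inj₁ (subst₂ (λ A B → atomTree A >ₗ atomTree B) (sym (atomOf-· K σ₀)) (sym (atomOf-· L σ₀))
                       (above (atomOf K) (atomOf L) cK flatL)))
    where
      above : ∀ A B → AnyV.Any IsCompound (Atom.args A) → ¬ AnyV.Any IsCompound (Atom.args B) →
              atomTree (A ·ᵃ σ₀) >ₗ atomTree (B ·ᵃ σ₀)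
      above (atom p ts) (atom q us) cA flatB =
        lpoSub (compound-argument ts cA λ f X → lpoPrec (fun>pred f q) (function-above-flat f X us flatB))

  dominant-compound-maximal : ∀ {C M} → HasCompound M → All (M ⪰₀_) (filter hasCompound? C) →
                              Maximal C M
  dominant-compound-maximal {C} {M} cM M⪰ = σ₀ , σ₀-ground , tabulate dominates
    where
      by-shape : ∀ {L} → L ∈ C → Dec (HasCompound L) → M ⪰₀ L
      by-shape L∈C (yes cL) = lookup M⪰ (∈-filter⁺ hasCompound? L∈C cL)
      by-shape {L} _ (no flatL) = compound-above-flat M L cM flatL

      dominates : ∀ {L} → L ∈ C → M ⪰₀ L
      dominates {L} L∈C = by-shape L∈C (hasCompound? L)

  maximal-compound : ∀ C → Any HasCompound C →
                     Σ Literal λ M → M ∈ C × Maximal C M × HasCompound M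
  maximal-compound C compound =
    let M , (M∈C , cM) , M⪰ = greatest-satisfying _⪰₀_ (inj₂ refl) ⪰₀-total ⪰-trans hasCompound? compound
    in M , M∈C , dominant-compound-maximal cM M⪰ , cM

  eligible⊆clause : ∀ {N C ℒ} → Eligible N C ℒ → ∀ {L} → ℒ L → L ∈ C
  eligible⊆clause (case1 _ ℒ⇔) {L} l = proj₁ (Equivalence.to (ℒ⇔ L) l)
  eligible⊆clause {C = C} (case2 _ L₀ L₀∈C _ _ ℒ⇔) {L} l = subst (_∈ C) (sym (Equivalence.to (ℒ⇔ L) l)) L₀∈C
  eligible⊆clause (case3 _ _ _ ℒ⇔) {L} l = proj₁ (Equivalence.to (ℒ⇔ L) l)
  eligible⊆clause {C = C} (case4 _ _ _ _ _ G (G∈C , _) ℒ⇔) {L} l = subst (_∈ C) (sym (Equivalence.to (ℒ⇔ L) l)) G∈C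
  eligible⊆clause (case5a _ _ _ _ _ _ _ ℒ⇔) {L} l = proj₁ (Equivalence.to (ℒ⇔ L) l)
  eligible⊆clause (case5b _ _ _ _ _ ℒ⇔) {L} l = proj₁ (Equivalence.to (ℒ⇔ L) l)

  eligible-covers : ∀ {N C ℒ x} → LooselyGuarded C → Eligible N C ℒ → x ∈ᶜ C → x ∈ˢ ℒ
  eligible-covers {x = x} _ (case1 C-ground _) x∈C = ⊥-elim (C-ground x x∈C)
  eligible-covers (_ , covering , _) (case2 _ L₀ L₀∈C _ compound ℒ⇔) x∈C =
    L₀ , Equivalence.from (ℒ⇔ L₀) refl , covering-literal covering L₀∈C compound x∈C
  eligible-covers {C = C} (_ , covering , _) (case3 _ _ posCompound ℒ⇔) x∈C =
    let M , M∈C , maximal , compound = maximal-compound C (Any.map proj₂ posCompound)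
    in M , Equivalence.from (ℒ⇔ M) (M∈C , maximal) , covering-literal covering M∈C compound x∈C
  eligible-covers {x = x} _ (case4 _ _ _ _ _ G (_ , _ , _ , G-vars) ℒ⇔) x∈C =
    G , Equivalence.from (ℒ⇔ G) refl , Equivalence.from (G-vars x) x∈C
  -- Case (5) with side premises: x lies in a negative literal, so a top
  -- variable y exists, and a negative literal containing x and y is selected.
  eligible-covers {C = C} lg (case5a _ _ _ _ _ σ′ _ ℒ⇔) x∈C =
    let L₁ , L₁∈C , L₁-neg , x∈L₁ , _ = co-occurrence lg x∈C x∈C
        y , top = top-variable C σ′ (lose L₁∈C (L₁-neg , x∈L₁))
        L , L∈C , L-neg , x∈L , y∈L = co-occurrence lg x∈C (Any.map proj₂ (proj₁ top))
    in L , Equivalence.from (ℒ⇔ L) (L∈C , L-neg , y , y∈L , top) , x∈L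
  eligible-covers lg (case5b _ _ _ _ _ ℒ⇔) x∈C =
    let L , L∈C , L-neg , x∈L , _ = co-occurrence lg x∈C x∈C
    in L , Equivalence.from (ℒ⇔ L) (L∈C , L-neg) , x∈L

mainTheorem9 : (S : Signature) (P : Syntax.Precedence S)
    (N : List (Syntax.Clause S)) (C : Syntax.Clause S)
    (ℒ : Syntax.Literal S → Set) →
    (Syntax.Guarded S C ⊎ Syntax.LooselyGuarded S C) →
    Order.Eligible S P N C ℒ →
    ∀ x → (Syntax._∈ˢ_ S x ℒ ⇔ Syntax._∈ᶜ_ S x C)
mainTheorem9 S P N C ℒ guarded eligible x =
  mk⇔ (λ { (L , l , x∈L) → lose (OrderFacts.eligible⊆clause S P eligible l) x∈L })
      (OrderFacts.eligible-covers S P looselyGuarded eligible)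
  where
    looselyGuarded : Syntax.LooselyGuarded S C
    looselyGuarded = [ ClauseFacts.guarded⇒looselyGuarded S , id ]′ guarded
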